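{- Let $h$ be an odd positive integer and $n=4h^2$. If there exists a circulant Hadamard matrix of order $n$, then there exists a weighing matrix of order $n/2$ and weight $n/4$.
   Context: A Hadamard matrix of order $n$ is an $n\times n$ matrix with entries in $\{ -1,1\}$ with $HH^{T}=nI_n$; it is circulant if each row is the cyclic right shift by one position of the previous row. A weighing matrix of order $n$ and weight $k$ ($n,k$ positive integers) is an $n\times n$ matrix $W$ with entries in $\{ -1,0,1\}$ such that $WW^{T}=kI_n$. -}

module Defs where

open import Data.Nat as ℕ using (ℕ; zero; suc; _∸_; _%_)
open import Data.Nat.DivMod using (m%n<n)
open import Data.Integer using (ℤ; +_; -[1+_]; _+_; _*_; 0ℤ)
open import Data.Fin using (Fin; toℕ; fromℕ<)
import Data.Fin
open import Data.Product using (Σ; ∃; _×_)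
open import Data.Sum using (_⊎_)
open import Relation.Binary.PropositionalEquality using (_≡_; _≢_)

Matrix : ℕ → Set
Matrix n = Fin n → Fin n → ℤ

∑ : (n : ℕ) → (Fin n → ℤ) → ℤ
∑ zero    f = 0ℤ
∑ (suc n) f = f Data.Fin.zero + ∑ n (λ i → f (Data.Fin.suc i))


MMᵀ : {n : ℕ} → Matrix n → Fin n → Fin n → ℤ
MMᵀ {n} M i j = ∑ n (λ k → M i k * M j k)

GramIsScalar : {n : ℕ} → Matrix n → ℤ → Set
GramIsScalar {n} M k =
  (i j : Fin n) → ((i ≡ j) → MMᵀ M i j ≡ k) × (i ≢ j → MMᵀ M i j ≡ 0ℤ)

IsHadamard : (n : ℕ) → Matrix n → Set
IsHadamard n H =
  ((i j : Fin n) → H i j ≡ + 1 ⊎ H i j ≡ -[1+ 0 ]) × GramIsScalar H (+ n)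

IsWeighing : (n k : ℕ) → Matrix n → Set
IsWeighing n k W =
  ((i j : Fin n) → W i j ≡ + 1 ⊎ W i j ≡ -[1+ 0 ] ⊎ W i j ≡ + 0) × GramIsScalar W (+ k)

-- circulant: entry (i,j) depends only on (j - i) mod n, i.e. each row is the
-- cyclic right shift of the previous one; H i j = c ((j - i) mod n) where c is row 0
IsCirculant : (n : ℕ) → .{{_ : ℕ.NonZero n}} → Matrix n → Set
IsCirculant n H =
  (i j : Fin n) → H i j ≡ H (fromℕ< (m%n<n 0 n)) (fromℕ< (m%n<n ((n ℕ.+ toℕ j) ∸ toℕ i) n))

HasCirculantHadamard : (n : ℕ) → .{{_ : ℕ.NonZero n}} → Set
HasCirculantHadamard n = Σ (Matrix n) (λ H → IsHadamard n H × IsCirculant n H)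

HasWeighing : (n k : ℕ) → Set
HasWeighing n k = Σ (Matrix n) (IsWeighing n k)

{-# OPTIONS --safe #-}
-- A circulant matrix H of even order 2m has block form [[A, B], [B, A]] with m × m blocks.
-- If H is Hadamard, the rows of A and B have ±1 entries, so W = (A + B)/2 has entries in
-- {-1, 0, 1}, and 4 WWᵀ = (AAᵀ + BBᵀ) + (ABᵀ + BAᵀ) is the sum of the top-left and top-right
-- blocks of HHᵀ = 2m I, namely 2m I + 0. Hence W is a weighing matrix of order m and weight
-- m/2; for m = 2h² this is weight h².
module Submission where

open import Defs
open import Data.Nat using (ℕ; zero; suc; _+_; _*_; _∸_; _%_; _≤_; NonZero)
open import Data.Nat.DivMod using ([m+n]%n≡m%n)
open import Data.Nat.Properties using ([m+n]∸[m+o]≡n∸o; +-∸-comm; +-comm; +-assoc; *-assoc; ≤-trans; <⇒≤; m≤m+n)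
import Data.Nat.Tactic.RingSolver as ℕ-Solver
open import Data.Integer as ℤ using (ℤ; +_; -[1+_]; 0ℤ)
open import Data.Integer.Properties using (*-zeroʳ; *-distribˡ-+; +-identityˡ; +-identityʳ; *-cancelˡ-≡; pos-*)
import Data.Integer.Properties as ℤ
open import Data.Integer.Tactic.RingSolver using (solve-∀)
open import Data.Fin using (Fin; toℕ; _↑ˡ_; _↑ʳ_; splitAt)
import Data.Fin as Fin
open import Data.Fin.Properties using (toℕ-↑ˡ; toℕ-↑ʳ; fromℕ<-cong; splitAt-↑ˡ; splitAt-↑ʳ; ↑ˡ-injective; toℕ<n)
open import Data.Product using (_,_; proj₁; proj₂)
open import Data.Sum using (_⊎_; inj₁; inj₂)
open import Function using (_∘_)
open import Relation.Binary.PropositionalEquality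
open ≡-Reasoning

∑-cong : ∀ n {f g : Fin n → ℤ} → (∀ k → f k ≡ g k) → ∑ n f ≡ ∑ n g
∑-cong zero    f≗g = refl
∑-cong (suc n) f≗g = cong₂ ℤ._+_ (f≗g Fin.zero) (∑-cong n (λ k → f≗g (Fin.suc k)))

∑-distrib-+ : ∀ n (f g : Fin n → ℤ) → ∑ n (λ k → f k ℤ.+ g k) ≡ ∑ n f ℤ.+ ∑ n g
∑-distrib-+ zero    f g = refl
∑-distrib-+ (suc n) f g =
  trans (cong (λ s → (f Fin.zero ℤ.+ g Fin.zero) ℤ.+ s) (∑-distrib-+ n (f ∘ Fin.suc) (g ∘ Fin.suc)))
        (interchange (f Fin.zero) (g Fin.zero) (∑ n (f ∘ Fin.suc)) (∑ n (g ∘ Fin.suc)))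
  where
  interchange : ∀ a b c d → (a ℤ.+ b) ℤ.+ (c ℤ.+ d) ≡ (a ℤ.+ c) ℤ.+ (b ℤ.+ d)
  interchange = solve-∀

*-distribˡ-∑ : ∀ n c (f : Fin n → ℤ) → c ℤ.* ∑ n f ≡ ∑ n (λ k → c ℤ.* f k)
*-distribˡ-∑ zero    c f = *-zeroʳ c
*-distribˡ-∑ (suc n) c f =
  trans (*-distribˡ-+ c (f Fin.zero) (∑ n (f ∘ Fin.suc)))
        (cong (λ s → c ℤ.* f Fin.zero ℤ.+ s) (*-distribˡ-∑ n c (f ∘ Fin.suc)))

∑-splitAt : ∀ m n (f : Fin (m + n) → ℤ) →
            ∑ (m + n) f ≡ ∑ m (λ i → f (i ↑ˡ n)) ℤ.+ ∑ n (λ j → f (m ↑ʳ j))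
∑-splitAt zero    n f = sym (+-identityˡ _)
∑-splitAt (suc m) n f =
  trans (cong (λ s → f Fin.zero ℤ.+ s) (∑-splitAt m n (f ∘ Fin.suc))) (sym (ℤ.+-assoc (f Fin.zero) _ _))

↑ˡ≢↑ʳ : ∀ {m n} (i : Fin m) (j : Fin n) → i ↑ˡ n ≢ m ↑ʳ j
↑ˡ≢↑ʳ {m} {n} i j eq with trans (sym (splitAt-↑ˡ m i n)) (trans (cong (splitAt m) eq) (splitAt-↑ʳ m n j))
... | ()

IsSign : ℤ → Set
IsSign x = x ≡ + 1 ⊎ x ≡ -[1+ 0 ]

IsTernary : ℤ → Set
IsTernary x = x ≡ + 1 ⊎ x ≡ -[1+ 0 ] ⊎ x ≡ + 0

-- (x + y) / 2 on signs; the junk value + 0 on other inputs is never used.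
average : ℤ → ℤ → ℤ
average (+ 1)    (+ 1)    = + 1
average -[1+ 0 ] -[1+ 0 ] = -[1+ 0 ]
average _        _        = + 0

average-double : ∀ {x y} → IsSign x → IsSign y → + 2 ℤ.* average x y ≡ x ℤ.+ y
average-double (inj₁ refl) (inj₁ refl) = refl
average-double (inj₁ refl) (inj₂ refl) = refl
average-double (inj₂ refl) (inj₁ refl) = refl
average-double (inj₂ refl) (inj₂ refl) = refl

average-ternary : ∀ {x y} → IsSign x → IsSign y → IsTernary (average x y)
average-ternary (inj₁ refl) (inj₁ refl) = inj₁ refl
average-ternary (inj₁ refl) (inj₂ refl) = inj₂ (inj₂ refl)
average-ternary (inj₂ refl) (inj₁ refl) = inj₂ (inj₂ refl)
average-ternary (inj₂ refl) (inj₂ refl) = inj₂ (inj₁ refl)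

cyclicOffset : (n : ℕ) .{{_ : NonZero n}} → ℕ → ℕ → ℕ
cyclicOffset n i j = ((n + j) ∸ i) % n

cyclicOffset-shift : ∀ n .{{_ : NonZero n}} m i j →
                     cyclicOffset n (m + i) (m + j) ≡ cyclicOffset n i j
cyclicOffset-shift n m i j = cong (_% n) (begin
  (n + (m + j)) ∸ (m + i)   ≡⟨ cong (_∸ (m + i)) (exchange n m j) ⟩
  (m + (n + j)) ∸ (m + i)   ≡⟨ [m+n]∸[m+o]≡n∸o m (n + j) i ⟩
  (n + j) ∸ i               ∎)
  where
  exchange : ∀ a b c → a + (b + c) ≡ b + (a + c)
  exchange = ℕ-Solver.solve-∀

cyclicOffset-half-turn : ∀ m .{{_ : NonZero (m + m)}} i j → i ≤ m →
                         cyclicOffset (m + m) i (m + j) ≡ cyclicOffset (m + m) (m + i) j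
cyclicOffset-half-turn m i j i≤m = begin
  ((n + (m + j)) ∸ i) % n     ≡⟨ cong (λ x → (x ∸ i) % n) (+-comm n (m + j)) ⟩
  ((m + j + n) ∸ i) % n       ≡⟨ cong (_% n) (+-∸-comm n (≤-trans i≤m (m≤m+n m j))) ⟩
  ((m + j ∸ i) + n) % n       ≡⟨ [m+n]%n≡m%n (m + j ∸ i) n ⟩
  (m + j ∸ i) % n             ≡⟨ cong (_% n) (sym ([m+n]∸[m+o]≡n∸o m (m + j) i)) ⟩
  (m + (m + j) ∸ (m + i)) % n ≡⟨ cong (λ x → (x ∸ (m + i)) % n) (sym (+-assoc m m j)) ⟩
  ((n + j) ∸ (m + i)) % n     ∎
  where n = m + m

circulant-entry : ∀ {n} .{{_ : NonZero n}} {H : Matrix n} → IsCirculant n H → ∀ {a b c d} →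
                  cyclicOffset n (toℕ a) (toℕ b) ≡ cyclicOffset n (toℕ c) (toℕ d) → H a b ≡ H c d
circulant-entry {H = H} circ {a} {b} {c} {d} eq =
  trans (circ a b) (trans (cong (H _) (fromℕ<-cong _ _ eq _ _)) (sym (circ c d)))

module EvenCirculant (m : ℕ) .{{_ : NonZero (m + m)}} {H : Matrix (m + m)} (circ : IsCirculant (m + m) H) where

  top bottom : Fin m → Fin (m + m)
  top i    = i ↑ˡ m
  bottom i = m ↑ʳ i

  diagonal-blocks : ∀ j k → H (top j) (top k) ≡ H (bottom j) (bottom k)
  diagonal-blocks j k = circulant-entry circ (begin
    cyclicOffset (m + m) (toℕ (top j)) (toℕ (top k))
      ≡⟨ cong₂ (cyclicOffset (m + m)) (toℕ-↑ˡ j m) (toℕ-↑ˡ k m) ⟩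
    cyclicOffset (m + m) (toℕ j) (toℕ k)
      ≡⟨ sym (cyclicOffset-shift (m + m) m (toℕ j) (toℕ k)) ⟩
    cyclicOffset (m + m) (m + toℕ j) (m + toℕ k)
      ≡⟨ sym (cong₂ (cyclicOffset (m + m)) (toℕ-↑ʳ m j) (toℕ-↑ʳ m k)) ⟩
    cyclicOffset (m + m) (toℕ (bottom j)) (toℕ (bottom k)) ∎)

  off-diagonal-blocks : ∀ j k → H (top j) (bottom k) ≡ H (bottom j) (top k)
  off-diagonal-blocks j k = circulant-entry circ (begin
    cyclicOffset (m + m) (toℕ (top j)) (toℕ (bottom k))
      ≡⟨ cong₂ (cyclicOffset (m + m)) (toℕ-↑ˡ j m) (toℕ-↑ʳ m k) ⟩
    cyclicOffset (m + m) (toℕ j) (m + toℕ k)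
      ≡⟨ cyclicOffset-half-turn m (toℕ j) (toℕ k) (<⇒≤ (toℕ<n j)) ⟩
    cyclicOffset (m + m) (m + toℕ j) (toℕ k)
      ≡⟨ sym (cong₂ (cyclicOffset (m + m)) (toℕ-↑ʳ m j) (toℕ-↑ˡ k m)) ⟩
    cyclicOffset (m + m) (toℕ (bottom j)) (toℕ (top k)) ∎)

module CirculantHadamardHalving (m : ℕ) .{{_ : NonZero (m + m)}} {H : Matrix (m + m)}
  (had : IsHadamard (m + m) H) (circ : IsCirculant (m + m) H) where

  open EvenCirculant m circ

  W : Matrix m
  W i k = average (H (top i) (top k)) (H (top i) (bottom k))

  W-ternary : ∀ i k → IsTernary (W i k)
  W-ternary i k = average-ternary (proj₁ had _ _) (proj₁ had _ _)

  double-W : ∀ i k → + 2 ℤ.* W i k ≡ H (top i) (top k) ℤ.+ H (top i) (bottom k)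
  double-W i k = average-double (proj₁ had _ _) (proj₁ had _ _)

  quadruple-WWᵀ : ∀ i j → + 4 ℤ.* MMᵀ W i j ≡ MMᵀ H (top i) (top j) ℤ.+ MMᵀ H (top i) (bottom j)
  quadruple-WWᵀ i j = begin
    + 4 ℤ.* MMᵀ W i j
      ≡⟨ *-distribˡ-∑ m (+ 4) _ ⟩
    ∑ m (λ k → + 4 ℤ.* (W i k ℤ.* W j k))
      ≡⟨ ∑-cong m expand ⟩
    ∑ m (λ k → (a k ℤ.* c k ℤ.+ b k ℤ.* d k) ℤ.+ (a k ℤ.* d′ k ℤ.+ b k ℤ.* c′ k))
      ≡⟨ ∑-distrib-+ m _ _ ⟩
    ∑ m (λ k → a k ℤ.* c k ℤ.+ b k ℤ.* d k) ℤ.+ ∑ m (λ k → a k ℤ.* d′ k ℤ.+ b k ℤ.* c′ k)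
      ≡⟨ cong₂ ℤ._+_ (∑-distrib-+ m _ _) (∑-distrib-+ m _ _) ⟩
    (∑ m (λ k → a k ℤ.* c k) ℤ.+ ∑ m (λ k → b k ℤ.* d k)) ℤ.+
    (∑ m (λ k → a k ℤ.* d′ k) ℤ.+ ∑ m (λ k → b k ℤ.* c′ k))
      ≡⟨ sym (cong₂ ℤ._+_ (∑-splitAt m m _) (∑-splitAt m m _)) ⟩
    MMᵀ H (top i) (top j) ℤ.+ MMᵀ H (top i) (bottom j) ∎
    where
    a b c d c′ d′ : Fin m → ℤ
    a k  = H (top i) (top k)
    b k  = H (top i) (bottom k)
    c k  = H (top j) (top k)
    d k  = H (top j) (bottom k)
    c′ k = H (bottom j) (bottom k)
    d′ k = H (bottom j) (top k)

    foil : ∀ x y z w → (x ℤ.+ y) ℤ.* (z ℤ.+ w) ≡ (x ℤ.* z ℤ.+ y ℤ.* w) ℤ.+ (x ℤ.* w ℤ.+ y ℤ.* z)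
    foil = solve-∀

    four : ∀ x y → + 4 ℤ.* (x ℤ.* y) ≡ (+ 2 ℤ.* x) ℤ.* (+ 2 ℤ.* y)
    four = solve-∀

    expand : ∀ k → + 4 ℤ.* (W i k ℤ.* W j k) ≡ (a k ℤ.* c k ℤ.+ b k ℤ.* d k) ℤ.+ (a k ℤ.* d′ k ℤ.+ b k ℤ.* c′ k)
    expand k = begin
      + 4 ℤ.* (W i k ℤ.* W j k)                                 ≡⟨ four (W i k) (W j k) ⟩
      (+ 2 ℤ.* W i k) ℤ.* (+ 2 ℤ.* W j k)                       ≡⟨ cong₂ ℤ._*_ (double-W i k) (double-W j k) ⟩
      (a k ℤ.+ b k) ℤ.* (c k ℤ.+ d k)                           ≡⟨ foil (a k) (b k) (c k) (d k) ⟩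
      (a k ℤ.* c k ℤ.+ b k ℤ.* d k) ℤ.+ (a k ℤ.* d k ℤ.+ b k ℤ.* c k)
        ≡⟨ cong₂ (λ x y → (a k ℤ.* c k ℤ.+ b k ℤ.* d k) ℤ.+ (a k ℤ.* x ℤ.+ b k ℤ.* y))
                 (off-diagonal-blocks j k) (diagonal-blocks j k) ⟩
      (a k ℤ.* c k ℤ.+ b k ℤ.* d k) ℤ.+ (a k ℤ.* d′ k ℤ.+ b k ℤ.* c′ k) ∎

  W-weighing : ∀ k → m + m ≡ 4 * k → IsWeighing m k W
  W-weighing k 2m≡4k = W-ternary , λ i j → W-diagonal i j , W-off-diagonal i j
    where
    gram : GramIsScalar H (+ (m + m))
    gram = proj₂ had

    W-diagonal : ∀ i j → i ≡ j → MMᵀ W i j ≡ + k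
    W-diagonal i j i≡j = *-cancelˡ-≡ (+ 4) _ _ (begin
      + 4 ℤ.* MMᵀ W i j
        ≡⟨ quadruple-WWᵀ i j ⟩
      MMᵀ H (top i) (top j) ℤ.+ MMᵀ H (top i) (bottom j)
        ≡⟨ cong₂ ℤ._+_ (proj₁ (gram _ _) (cong top i≡j)) (proj₂ (gram _ _) (↑ˡ≢↑ʳ i j)) ⟩
      + (m + m) ℤ.+ 0ℤ  ≡⟨ +-identityʳ _ ⟩
      + (m + m)         ≡⟨ cong +_ 2m≡4k ⟩
      + (4 * k)         ≡⟨ pos-* 4 k ⟩
      + 4 ℤ.* + k       ∎)

    W-off-diagonal : ∀ i j → i ≢ j → MMᵀ W i j ≡ 0ℤ
    W-off-diagonal i j i≢j = *-cancelˡ-≡ (+ 4) _ _ (begin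
      + 4 ℤ.* MMᵀ W i j
        ≡⟨ quadruple-WWᵀ i j ⟩
      MMᵀ H (top i) (top j) ℤ.+ MMᵀ H (top i) (bottom j)
        ≡⟨ cong₂ ℤ._+_ (proj₂ (gram _ _) (i≢j ∘ ↑ˡ-injective m i j)) (proj₂ (gram _ _) (↑ˡ≢↑ʳ i j)) ⟩
      0ℤ ∎)

circulantHadamard⇒weighing : ∀ n m k .{{_ : NonZero n}} → n ≡ m + m → n ≡ 4 * k →
                             HasCirculantHadamard n → HasWeighing m k
circulantHadamard⇒weighing .(m + m) m k refl 2m≡4k (H , had , circ) =
  W , W-weighing k 2m≡4k
  where open CirculantHadamardHalving m had circ

lemma2p4 : (t : ℕ) → let h = suc (2 * t) in
    HasCirculantHadamard (4 * h * h) → HasWeighing (2 * h * h) (h * h)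
lemma2p4 t = circulantHadamard⇒weighing (4 * h * h) (2 * h * h) (h * h) (4h²≡2h²+2h² h) (*-assoc 4 h h)
  where
  h = suc (2 * t)
  4h²≡2h²+2h² : ∀ h → 4 * h * h ≡ 2 * h * h + 2 * h * h
  4h²≡2h²+2h² = ℕ-Solver.solve-∀
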